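{- For all $k,n\ge 0$, every $k$-twist congruence class of $\mathfrak S_n$ is an interval of the (right) weak order on $\mathfrak S_n$.
   Context: The $k$-twist congruence $\equiv^k$ on $\mathfrak S_n$ (permutations written in one-line notation as words) is the transitive closure of the rewriting rule $U\,a\,c\,V_1\,b_1\,V_2\,b_2\cdots V_k\,b_k\,W\equiv^k U\,c\,a\,V_1\,b_1\,V_2\,b_2\cdots V_k\,b_k\,W$ whenever $a<b_i<c$ for all $i\in[k]$, where $a,b_1,\dots,b_k,c\in[n]$ and $U,V_1,\dots,V_k,W$ are (possibly empty) words on $[n]$. A coinversion of $\tau\in\mathfrak S_n$ is a pair $i<j$ with $\tau^{ -1}(i)>\tau^{ -1}(j)$; the weak order is $\tau\le\tau'$ iff every coinversion of $\tau$ is a coinversion of $\tau'$. An interval is a set $\{\sigma:\tau\le\sigma\le\tau'\}$. -}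

module Defs where

open import Data.Nat using (ℕ)
open import Data.Fin using (Fin; _<_)
open import Data.List using (List; _∷_; _++_; allFin)
open import Data.Vec using (Vec; foldr′)
open import Data.Vec.Relation.Unary.All using (All)
open import Data.Product using (Σ; _×_; _,_; ∃; proj₂)
open import Data.Sum using (_⊎_)
open import Data.List.Relation.Binary.Permutation.Propositional using (_↭_)
open import Relation.Binary.PropositionalEquality using (_≡_)
open import Relation.Binary.Construct.Closure.ReflexiveTransitive using (Star)

-- Permutations of [n] = {0,…,n-1} (Fin n) in one-line notation: words that
-- are rearrangements of 0,1,…,n-1.
IsPerm : (n : ℕ) → List (Fin n) → Set
IsPerm n w = w ↭ allFin n

block : ∀ {n k} → Vec (List (Fin n) × Fin n) k → List (Fin n) → List (Fin n)
block Vbs W = foldr′ (λ { (V , b) r → V ++ (b ∷ r) }) W Vbs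

TwistStep : (k : ℕ) {n : ℕ} → List (Fin n) → List (Fin n) → Set
TwistStep k {n} w w′ =
  Σ (List (Fin n)) λ U → Σ (Fin n) λ a → Σ (Fin n) λ c →
  Σ (Vec (List (Fin n) × Fin n) k) λ Vbs → Σ (List (Fin n)) λ W →
    All (λ Vb → a < proj₂ Vb × proj₂ Vb < c) Vbs
    × w ≡ U ++ (a ∷ c ∷ block Vbs W)
    × w′ ≡ U ++ (c ∷ a ∷ block Vbs W)

TwistSym : (k : ℕ) {n : ℕ} → List (Fin n) → List (Fin n) → Set
TwistSym k w w′ = TwistStep k w w′ ⊎ TwistStep k w′ w

_≡[_]ᵗ_ : {n : ℕ} → List (Fin n) → ℕ → List (Fin n) → Set
w ≡[ k ]ᵗ w′ = Star (TwistSym k) w w′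

Before : ∀ {n} → List (Fin n) → Fin n → Fin n → Set
Before {n} w x y = Σ (List (Fin n)) λ U → Σ (List (Fin n)) λ V → Σ (List (Fin n)) λ W →
  w ≡ U ++ (x ∷ V ++ (y ∷ W))

-- (i , j) is a coinversion of τ: i < j and τ⁻¹(i) > τ⁻¹(j), i.e. j occurs before i.
Coinversion : ∀ {n} → List (Fin n) → Fin n → Fin n → Set
Coinversion τ i j = i < j × Before τ j i

_≤W_ : ∀ {n} → List (Fin n) → List (Fin n) → Set
τ ≤W τ′ = ∀ i j → Coinversion τ i j → Coinversion τ′ i j

module Submission where

-- We prove, by induction on j ≤ n, that every class of the k-twist congruence
-- on the permutations of {0,…,j-1} is an interval [τ, τ′].  Deleting the
-- largest letter m = j from a word is compatible with the congruence, and a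
-- class is determined by two invariants of its members ρ:
--   * the class of ρ with m deleted, and
--   * the next barrier after m: the first letter y following m in ρ that has
--     fewer than k larger letters to its right (the "barriers" of ρ).
-- Barriers are themselves invariant under the congruence, and a barrier never
-- changes its relative position with a larger letter.  Hence the class of σ
-- consists of the words obtained by inserting m into a member of the smaller
-- class so that no barrier lies between m and the target t = next barrier.
-- The minimum τ inserts m into the smaller minimum τ₀ directly before t; the
-- maximum τ′ inserts m into the smaller maximum τ₀′ directly after the last
-- barrier that precedes t.

open import Defs
open import Data.Nat using (ℕ)
open import Data.Fin using (Fin)
open import Data.List using (List)
open import Data.Product using (Σ; _×_)
open import Function.Bundles using (_⇔_)

open import Data.Nat as ℕ using (zero; suc; z≤n; s≤s) renaming (_≤_ to _≤ℕ_; _<_ to _<ℕ_)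
import Data.Nat.Properties as NP
open import Data.Fin using (toℕ; fromℕ<) renaming (_<_ to _<F_; _≤_ to _≤F_)
import Data.Fin.Properties as FP
open import Data.Fin.Properties using (_≟_; _<?_)
open import Data.List using ([]; _∷_; _++_; [_])
open import Data.List.Properties using (++-assoc; ++-identityʳ)
open import Data.List.Membership.Propositional using (_∈_; _∉_)
import Data.List.Membership.Propositional.Properties as MP
open import Data.List.Membership.DecPropositional using () renaming (_∈?_ to member?)
open import Data.List.Relation.Unary.Any using (here; there)
open import Data.List.Relation.Unary.All as All using (All; []; _∷_)
open import Data.List.Relation.Unary.All.Properties using (All¬⇒¬Any)
open import Data.List.Relation.Unary.AllPairs using ([]; _∷_)
open import Data.List.Relation.Unary.Unique.Propositional using (Unique)
import Data.List.Relation.Unary.Unique.Propositional.Properties as UniqueP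
open import Data.List.Relation.Binary.Permutation.Propositional using (↭-sym; ↭⇒↭ₛ)
import Data.List.Relation.Binary.Permutation.Propositional.Properties as PermP
import Data.List.Relation.Binary.Permutation.Setoid.Properties as PermₛP
open import Data.List.Membership.Propositional.Properties.WithK using (unique∧set⇒bag)
open import Data.List.Relation.Binary.BagAndSetEquality using (∼bag⇒↭)
open import Data.Vec using (Vec; []; _∷_)
import Data.Vec.Relation.Unary.All as VecAll
open import Data.Product using (_,_; proj₁; proj₂; ∃)
open import Data.Sum using (_⊎_; inj₁; inj₂)
open import Data.Empty using (⊥; ⊥-elim)
open import Data.Unit using (⊤; tt)
open import Data.Maybe using (Maybe; just; nothing)
open import Relation.Nullary using (¬_; Dec; yes; no; contradiction)
open import Relation.Binary.Definitions using (tri<; tri≈; tri>)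
open import Relation.Binary.PropositionalEquality as ≡ using (_≡_; _≢_; refl; sym; trans; cong; cong₂; subst)
open import Relation.Binary.Construct.Closure.ReflexiveTransitive using (Star; ε; _◅_; _◅◅_)
open import Function.Bundles using (mk⇔)

module Words (n : ℕ) where

  Word : Set
  Word = List (Fin n)

  All≢⇒∉ : ∀ {x : Fin n} {w} → All (x ≢_) w → x ∉ w
  All≢⇒∉ = All¬⇒¬Any

  -- Bef w x y : x occurs strictly before y in w (an inductive form of
  -- Defs.Before, convenient for recursion on w).
  data Bef : Word → Fin n → Fin n → Set where
    now   : ∀ {x y w} → y ∈ w → Bef (x ∷ w) x y
    later : ∀ {z x y w} → Bef w x y → Bef (z ∷ w) x y

  Bef⇒Before : ∀ {w x y} → Bef w x y → Before w x y
  Bef⇒Before (now y∈) with MP.∈-∃++ y∈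
  ... | V , W , refl = [] , V , W , refl
  Bef⇒Before {z ∷ w} (later b) with Bef⇒Before b
  ... | U , V , W , refl = z ∷ U , V , W , refl

  Before⇒Bef : ∀ {w x y} → Before w x y → Bef w x y
  Before⇒Bef ([] , V , W , refl) = now (MP.∈-++⁺ʳ V (here refl))
  Before⇒Bef (z ∷ U , V , W , refl) = later (Before⇒Bef (U , V , W , refl))

  Bef-∈ˡ : ∀ {w x y} → Bef w x y → x ∈ w
  Bef-∈ˡ (now _) = here refl
  Bef-∈ˡ (later b) = there (Bef-∈ˡ b)

  Bef-∈ʳ : ∀ {w x y} → Bef w x y → y ∈ w
  Bef-∈ʳ (now p) = there p
  Bef-∈ʳ (later b) = there (Bef-∈ʳ b)

  Bef-tail : ∀ {z w x y} → Bef (z ∷ w) x y → x ≢ z → Bef w x y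
  Bef-tail (now _) x≢z = ⊥-elim (x≢z refl)
  Bef-tail (later b) _ = b

  Bef-irrefl : ∀ {w x} → Unique w → ¬ Bef w x x
  Bef-irrefl (z≢ ∷ _) (now p) = All≢⇒∉ z≢ p
  Bef-irrefl (_ ∷ u) (later b) = Bef-irrefl u b

  Bef-trans : ∀ {w x y z} → Unique w → Bef w x y → Bef w y z → Bef w x z
  Bef-trans u (now p) b = now (Bef-∈ʳ (Bef-tail b λ { refl → Bef-irrefl u (now p) }))
  Bef-trans (z≢ ∷ _) (later b) (now _) = ⊥-elim (All≢⇒∉ z≢ (Bef-∈ʳ b))
  Bef-trans (_ ∷ u) (later b) (later b′) = later (Bef-trans u b b′)

  Bef-total : ∀ {w x y} → x ∈ w → y ∈ w → x ≢ y → Bef w x y ⊎ Bef w y x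
  Bef-total (here refl) (here refl) x≢y = ⊥-elim (x≢y refl)
  Bef-total (here refl) (there q) _ = inj₁ (now q)
  Bef-total (there p) (here refl) _ = inj₂ (now p)
  Bef-total (there p) (there q) x≢y with Bef-total p q x≢y
  ... | inj₁ b = inj₁ (later b)
  ... | inj₂ b = inj₂ (later b)

  Bef-split : ∀ (X : Word) {z Y x} → x ∈ Y → Bef (X ++ z ∷ Y) z x
  Bef-split [] p = now p
  Bef-split (_ ∷ X) p = later (Bef-split X p)

  Bef-split⁻ : ∀ (X : Word) {z Y x} → z ∉ X → z ∉ Y → Bef (X ++ z ∷ Y) z x → x ∈ Y
  Bef-split⁻ [] _ _ (now p) = p
  Bef-split⁻ [] _ z∉Y (later b) = ⊥-elim (z∉Y (Bef-∈ˡ b))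
  Bef-split⁻ (_ ∷ X) z∉X _ (now _) = ⊥-elim (z∉X (here refl))
  Bef-split⁻ (_ ∷ X) z∉X z∉Y (later b) = Bef-split⁻ X (λ p → z∉X (there p)) z∉Y b

  _≼_ : Word → Word → Set
  τ ≼ ρ = ∀ i j → i <F j → Bef τ j i → Bef ρ j i

  ≼-refl : ∀ {u} → u ≼ u
  ≼-refl _ _ _ b = b

  ≼-trans : ∀ {u v w} → u ≼ v → v ≼ w → u ≼ w
  ≼-trans h₁ h₂ i j i<j b = h₂ i j i<j (h₁ i j i<j b)

  ≼⇒≤W : ∀ {τ ρ} → τ ≼ ρ → τ ≤W ρ
  ≼⇒≤W h i j (i<j , b) = i<j , Bef⇒Before (h i j i<j (Before⇒Bef b))

  ≤W⇒≼ : ∀ {τ ρ} → τ ≤W ρ → τ ≼ ρ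
  ≤W⇒≼ h i j i<j b = Before⇒Bef (proj₂ (h i j (i<j , Bef⇒Before b)))

  ∈-swap : ∀ (U : Word) a c R {x} → x ∈ U ++ a ∷ c ∷ R → x ∈ U ++ c ∷ a ∷ R
  ∈-swap [] a c R (here p) = there (here p)
  ∈-swap [] a c R (there (here p)) = here p
  ∈-swap [] a c R (there (there p)) = there (there p)
  ∈-swap (_ ∷ U) a c R (here p) = here p
  ∈-swap (_ ∷ U) a c R (there p) = there (∈-swap U a c R p)

  All-swap : ∀ {P : Fin n → Set} (U : Word) a c R → All P (U ++ a ∷ c ∷ R) → All P (U ++ c ∷ a ∷ R)
  All-swap U a c R al = All.tabulate (λ x∈ → All.lookup al (∈-swap U c a R x∈))

  Unique-swap : ∀ (U : Word) a c R → Unique (U ++ a ∷ c ∷ R) → Unique (U ++ c ∷ a ∷ R)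
  Unique-swap [] a c R ((a≢c ∷ a≢R) ∷ (c≢R ∷ uR)) = ((λ e → a≢c (sym e)) ∷ c≢R) ∷ (a≢R ∷ uR)
  Unique-swap (_ ∷ U) a c R (y≢ ∷ u) = All-swap U a c R y≢ ∷ Unique-swap U a c R u

  Bef-swap : ∀ (U : Word) {a c R x y} → Bef (U ++ a ∷ c ∷ R) x y → ¬ (x ≡ a × y ≡ c) → Bef (U ++ c ∷ a ∷ R) x y
  Bef-swap [] (now (here refl)) ne = ⊥-elim (ne (refl , refl))
  Bef-swap [] (now (there p)) _ = later (now p)
  Bef-swap [] (later (now p)) _ = now (there p)
  Bef-swap [] (later (later b)) _ = later (later b)
  Bef-swap (_ ∷ U) (now p) _ = now (∈-swap U _ _ _ p)
  Bef-swap (_ ∷ U) (later b) ne = later (Bef-swap U b ne)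

  ∉-++ : ∀ (X : Word) {Y z} → z ∉ X ++ Y → z ∉ X × z ∉ Y
  ∉-++ X z∉ = (λ p → z∉ (MP.∈-++⁺ˡ p)) , (λ p → z∉ (MP.∈-++⁺ʳ X p))

  ∈-insert⁻ : ∀ (X : Word) {Y z x} → x ∈ X ++ z ∷ Y → x ≡ z ⊎ x ∈ X ++ Y
  ∈-insert⁻ X p with MP.∈-++⁻ X p
  ... | inj₁ q = inj₂ (MP.∈-++⁺ˡ q)
  ... | inj₂ (here e) = inj₁ e
  ... | inj₂ (there q) = inj₂ (MP.∈-++⁺ʳ X q)

  ∈-insert⁺ : ∀ (X : Word) {Y z x} → x ∈ X ++ Y → x ∈ X ++ z ∷ Y
  ∈-insert⁺ X p with MP.∈-++⁻ X p
  ... | inj₁ q = MP.∈-++⁺ˡ q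
  ... | inj₂ q = MP.∈-++⁺ʳ X (there q)

  Unique-insert : ∀ (X : Word) {Y z} → Unique (X ++ Y) → z ∉ X ++ Y → Unique (X ++ z ∷ Y)
  Unique-insert [] u z∉ = All.tabulate (λ p e → z∉ (subst (_∈ _) (sym e) p)) ∷ u
  Unique-insert (x ∷ X) {Y} {z} (x≢ ∷ u) z∉ = All.tabulate x≢insert ∷ Unique-insert X u (λ p → z∉ (there p))
    where
    x≢insert : ∀ {y} → y ∈ X ++ z ∷ Y → x ≢ y
    x≢insert p with ∈-insert⁻ X p
    ... | inj₁ refl = λ e → z∉ (here (sym e))
    ... | inj₂ q = All.lookup x≢ q

  Unique-disjoint : ∀ (X : Word) {Y y} → Unique (X ++ Y) → y ∈ X → y ∈ Y → ⊥
  Unique-disjoint (_ ∷ X) (x≢ ∷ _) (here refl) q = All≢⇒∉ x≢ (MP.∈-++⁺ʳ X q)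
  Unique-disjoint (_ ∷ X) (_ ∷ u) (there p) q = Unique-disjoint X u p q

  PermOf : ℕ → Word → Set
  PermOf j w = Unique w × (∀ {x} → x ∈ w → toℕ x <ℕ j) × (∀ x → toℕ x <ℕ j → x ∈ w)

  PermOf-0 : ∀ {w} → PermOf 0 w → w ≡ []
  PermOf-0 {[]} _ = refl
  PermOf-0 {_ ∷ _} (_ , bounded , _) with bounded (here refl)
  ... | ()

  IsPerm⇒PermOf : ∀ {w} → IsPerm n w → PermOf n w
  IsPerm⇒PermOf w↭ =
    PermₛP.Unique-resp-↭ (≡.setoid (Fin n)) (↭⇒↭ₛ (↭-sym w↭)) (UniqueP.allFin⁺ n) ,
    (λ {x} _ → FP.toℕ<n x) ,
    λ x _ → PermP.∈-resp-↭ (↭-sym w↭) (MP.∈-allFin x)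

  PermOf⇒IsPerm : ∀ {w} → PermOf n w → IsPerm n w
  PermOf⇒IsPerm (u , _ , complete) =
    ∼bag⇒↭ (unique∧set⇒bag u (UniqueP.allFin⁺ n)
      λ {x} → mk⇔ (λ _ → MP.∈-allFin x) (λ _ → complete x (FP.toℕ<n x)))

module Twist (k n : ℕ) where
  open Words n

  between : Fin n → Fin n → Word → ℕ
  between a c [] = 0
  between a c (y ∷ R) with a <? y | y <? c
  ... | yes _ | yes _ = suc (between a c R)
  ... | yes _ | no _ = between a c R
  ... | no _ | _ = between a c R

  above : Fin n → Word → ℕ
  above y [] = 0
  above y (x ∷ R) with y <? x
  ... | yes _ = suc (above y R)
  ... | no _ = above y R

  between-++ : ∀ a c U R → between a c (U ++ R) ≡ between a c U ℕ.+ between a c R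
  between-++ a c [] R = refl
  between-++ a c (y ∷ U) R with a <? y | y <? c
  ... | yes _ | yes _ = cong suc (between-++ a c U R)
  ... | yes _ | no _ = between-++ a c U R
  ... | no _ | _ = between-++ a c U R

  between-cons≥ : ∀ a c y R → between a c R ≤ℕ between a c (y ∷ R)
  between-cons≥ a c y R with a <? y | y <? c
  ... | yes _ | yes _ = NP.n≤1+n _
  ... | yes _ | no _ = NP.≤-refl
  ... | no _ | _ = NP.≤-refl

  between-monoʳ : ∀ a c c′ R → c ≤F c′ → between a c R ≤ℕ between a c′ R
  between-monoʳ a c c′ [] _ = z≤n
  between-monoʳ a c c′ (y ∷ R) c≤c′ with a <? y | y <? c | y <? c′
  ... | yes _ | yes _ | yes _ = s≤s (between-monoʳ a c c′ R c≤c′)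
  ... | yes _ | yes y<c | no y≮c′ = ⊥-elim (y≮c′ (NP.<-≤-trans y<c c≤c′))
  ... | yes _ | no _ | yes _ = NP.m≤n⇒m≤1+n (between-monoʳ a c c′ R c≤c′)
  ... | yes _ | no _ | no _ = between-monoʳ a c c′ R c≤c′
  ... | no _ | _ | _ = between-monoʳ a c c′ R c≤c′

  between≤above : ∀ a c R → between a c R ≤ℕ above a R
  between≤above a c [] = z≤n
  between≤above a c (y ∷ R) with a <? y | y <? c
  ... | yes _ | yes _ = s≤s (between≤above a c R)
  ... | yes _ | no _ = NP.m≤n⇒m≤1+n (between≤above a c R)
  ... | no _ | _ = between≤above a c R

  between>0⇒< : ∀ a c R → 0 <ℕ between a c R → a <F c
  between>0⇒< a c (y ∷ R) p with a <? y | y <? c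
  ... | yes a<y | yes y<c = FP.<-trans a<y y<c
  ... | yes _ | no _ = between>0⇒< a c R p
  ... | no _ | _ = between>0⇒< a c R p

  above-cons≥ : ∀ y x R → above y R ≤ℕ above y (x ∷ R)
  above-cons≥ y x R with y <? x
  ... | yes _ = NP.n≤1+n _
  ... | no _ = NP.≤-refl

  above₁ : Fin n → Fin n → ℕ
  above₁ y x = above y [ x ]

  above-cons : ∀ y x R → above y (x ∷ R) ≡ above₁ y x ℕ.+ above y R
  above-cons y x R with y <? x
  ... | yes _ = refl
  ... | no _ = refl

  above-swap : ∀ y (U : Word) a c R → above y (U ++ a ∷ c ∷ R) ≡ above y (U ++ c ∷ a ∷ R)
  above-swap y [] a c R = begin
    above y (a ∷ c ∷ R)                        ≡⟨ above-cons y a (c ∷ R) ⟩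
    ι a ℕ.+ above y (c ∷ R)                    ≡⟨ cong (ι a ℕ.+_) (above-cons y c R) ⟩
    ι a ℕ.+ (ι c ℕ.+ above y R)                ≡⟨ NP.+-assoc (ι a) (ι c) (above y R) ⟨
    (ι a ℕ.+ ι c) ℕ.+ above y R                ≡⟨ cong (ℕ._+ above y R) (NP.+-comm (ι a) (ι c)) ⟩
    (ι c ℕ.+ ι a) ℕ.+ above y R                ≡⟨ NP.+-assoc (ι c) (ι a) (above y R) ⟩
    ι c ℕ.+ (ι a ℕ.+ above y R)                ≡⟨ cong (ι c ℕ.+_) (above-cons y a R) ⟨
    ι c ℕ.+ above y (a ∷ R)                    ≡⟨ above-cons y c (a ∷ R) ⟨
    above y (c ∷ a ∷ R)                        ∎
    where
    open ≡.≡-Reasoning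
    ι : Fin n → ℕ
    ι = above₁ y
  above-swap y (x ∷ U) a c R with y <? x
  ... | yes _ = cong suc (above-swap y U a c R)
  ... | no _ = above-swap y U a c R

  data Step : Word → Word → Set where
    swap : ∀ U a c R → k ≤ℕ between a c R → Step (U ++ a ∷ c ∷ R) (U ++ c ∷ a ∷ R)

  data Sym : Word → Word → Set where
    fwd : ∀ {u v} → Step u v → Sym u v
    bwd : ∀ {u v} → Step v u → Sym u v

  _≈_ : Word → Word → Set
  _≈_ = Star Sym

  Sym-sym : ∀ {u v} → Sym u v → Sym v u
  Sym-sym (fwd s) = bwd s
  Sym-sym (bwd s) = fwd s

  ≈-sym : ∀ {u v} → u ≈ v → v ≈ u
  ≈-sym ε = ε
  ≈-sym (s ◅ p) = ≈-sym p ◅◅ (Sym-sym s ◅ ε)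

  Step⇒≈ : ∀ {u v} → Step u v → u ≈ v
  Step⇒≈ s = fwd s ◅ ε

  ≈-cons : ∀ x {u v} → u ≈ v → (x ∷ u) ≈ (x ∷ v)
  ≈-cons x ε = ε
  ≈-cons x (s ◅ p) = Sym-cons s ◅ ≈-cons x p
    where
    Step-cons : ∀ {u v} → Step u v → Step (x ∷ u) (x ∷ v)
    Step-cons (swap U a c R p) = swap (x ∷ U) a c R p
    Sym-cons : ∀ {u v} → Sym u v → Sym (x ∷ u) (x ∷ v)
    Sym-cons (fwd s) = fwd (Step-cons s)
    Sym-cons (bwd s) = bwd (Step-cons s)

  -- Step is the rule TwistStep of Defs: a suffix R contains k letters
  -- between a and c exactly when it factors as V₁ b₁ ⋯ V_k b_k W.
  block-between : ∀ {a c j} (Vbs : Vec (Word × Fin n) j) W →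
    VecAll.All (λ Vb → a <F proj₂ Vb × proj₂ Vb <F c) Vbs → j ≤ℕ between a c (block Vbs W)
  block-between [] W VecAll.[] = z≤n
  block-between {a} {c} ((V , b) ∷ Vbs) W ((a<b , b<c) VecAll.∷ al) = begin
    suc _                               ≤⟨ head ⟩
    between a c (b ∷ block Vbs W)       ≤⟨ NP.m≤n+m _ (between a c V) ⟩
    between a c V ℕ.+ between a c (b ∷ block Vbs W) ≡⟨ between-++ a c V (b ∷ block Vbs W) ⟨
    between a c (V ++ b ∷ block Vbs W)  ∎
    where
    open NP.≤-Reasoning
    head : suc _ ≤ℕ between a c (b ∷ block Vbs W)
    head with a <? b | b <? c
    ... | yes _ | yes _ = s≤s (block-between Vbs W al)
    ... | yes _ | no b≮c = contradiction b<c b≮c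
    ... | no a≮b | _ = contradiction a<b a≮b

  between⇒block : ∀ {a c} j R → j ≤ℕ between a c R →
    Σ (Vec (Word × Fin n) j) λ Vbs → Σ Word λ W →
      VecAll.All (λ Vb → a <F proj₂ Vb × proj₂ Vb <F c) Vbs × block Vbs W ≡ R
  between⇒block zero R _ = [] , R , VecAll.[] , refl
  between⇒block {a} {c} (suc j) (y ∷ R) p with a <? y | y <? c
  ... | yes a<y | yes y<c with between⇒block j R (NP.≤-pred p)
  ...   | Vbs , W , al , refl = (([] , y) ∷ Vbs) , W , ((a<y , y<c) VecAll.∷ al) , refl
  between⇒block (suc j) (y ∷ R) p | yes _ | no _ with between⇒block (suc j) R p
  ...   | ((V , b) ∷ Vbs) , W , (q VecAll.∷ al) , refl = (((y ∷ V) , b) ∷ Vbs) , W , (q VecAll.∷ al) , refl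
  between⇒block (suc j) (y ∷ R) p | no _ | _ with between⇒block (suc j) R p
  ...   | ((V , b) ∷ Vbs) , W , (q VecAll.∷ al) , refl = (((y ∷ V) , b) ∷ Vbs) , W , (q VecAll.∷ al) , refl

  TwistStep⇒Step : ∀ {w w′} → TwistStep k w w′ → Step w w′
  TwistStep⇒Step (U , a , c , Vbs , W , al , refl , refl) = swap U a c (block Vbs W) (block-between Vbs W al)

  Step⇒TwistStep : ∀ {w w′} → Step w w′ → TwistStep k w w′
  Step⇒TwistStep (swap U a c R p) with between⇒block k R p
  ... | Vbs , W , al , refl = U , a , c , Vbs , W , al , refl , refl

  ≈⇒≡ᵗ : ∀ {w w′} → w ≈ w′ → w ≡[ k ]ᵗ w′
  ≈⇒≡ᵗ ε = ε
  ≈⇒≡ᵗ (fwd s ◅ p) = inj₁ (Step⇒TwistStep s) ◅ ≈⇒≡ᵗ p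
  ≈⇒≡ᵗ (bwd s ◅ p) = inj₂ (Step⇒TwistStep s) ◅ ≈⇒≡ᵗ p

  ≡ᵗ⇒≈ : ∀ {w w′} → w ≡[ k ]ᵗ w′ → w ≈ w′
  ≡ᵗ⇒≈ ε = ε
  ≡ᵗ⇒≈ (inj₁ s ◅ p) = fwd (TwistStep⇒Step s) ◅ ≡ᵗ⇒≈ p
  ≡ᵗ⇒≈ (inj₂ s ◅ p) = bwd (TwistStep⇒Step s) ◅ ≡ᵗ⇒≈ p

  Unique-resp-Sym : ∀ {u v} → Sym u v → Unique u → Unique v
  Unique-resp-Sym (fwd (swap U a c R _)) = Unique-swap U a c R
  Unique-resp-Sym (bwd (swap U a c R _)) = Unique-swap U c a R

  -- y is a barrier of u: y occurs in u with fewer than k larger letters to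
  -- its right.  Such a letter can never be the smaller letter of a twist.
  Barrier : Word → Fin n → Set
  Barrier [] y = ⊥
  Barrier (x ∷ u) y = (x ≡ y × above y u <ℕ k) ⊎ Barrier u y

  Barrier⇒∈ : ∀ {w y} → Barrier w y → y ∈ w
  Barrier⇒∈ {_ ∷ _} (inj₁ (refl , _)) = here refl
  Barrier⇒∈ {_ ∷ _} (inj₂ b) = there (Barrier⇒∈ b)

  Barrier⇒k>0 : ∀ {u y} → Barrier u y → 0 <ℕ k
  Barrier⇒k>0 {_ ∷ _} (inj₁ (_ , q)) = NP.≤-<-trans z≤n q
  Barrier⇒k>0 {_ ∷ u} (inj₂ b) = Barrier⇒k>0 {u} b

  Barrier-at : ∀ (U : Word) {y R} → Unique (U ++ y ∷ R) → Barrier (U ++ y ∷ R) y → above y R <ℕ k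
  Barrier-at [] _ (inj₁ (_ , q)) = q
  Barrier-at [] (y≢ ∷ _) (inj₂ b) = ⊥-elim (All≢⇒∉ y≢ (Barrier⇒∈ b))
  Barrier-at (_ ∷ U) (x≢ ∷ _) (inj₁ (refl , _)) = ⊥-elim (All≢⇒∉ x≢ (MP.∈-++⁺ʳ U (here refl)))
  Barrier-at (_ ∷ U) (_ ∷ u) (inj₂ b) = Barrier-at U u b

  above<k-tail : ∀ {y x R} → above y (x ∷ R) <ℕ k → above y R <ℕ k
  above<k-tail {y} {x} {R} = NP.≤-<-trans (above-cons≥ y x R)

  step⇒< : ∀ {a c R} → k ≤ℕ between a c R → 0 <ℕ k → a <F c
  step⇒< {a} {c} {R} p k>0 = between>0⇒< a c R (NP.<-≤-trans k>0 p)

  left-not-barrier : ∀ {a c R} → k ≤ℕ between a c R → ¬ (above a R <ℕ k)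
  left-not-barrier {a} {c} {R} p q = NP.<-irrefl refl (NP.<-≤-trans q (NP.≤-trans p (between≤above a c R)))

  left-not-barrier′ : ∀ {a c R} → k ≤ℕ between a c R → ¬ (above a (c ∷ R) <ℕ k)
  left-not-barrier′ {a} {c} {R} p q = left-not-barrier {a} {c} {R} p (above<k-tail {a} {c} {R} q)

  right-barrier⁺ : ∀ {a c R} → k ≤ℕ between a c R → above c R <ℕ k → above c (a ∷ R) <ℕ k
  right-barrier⁺ {a} {c} {R} p q with c <? a
  ... | no _ = q
  ... | yes c<a = ⊥-elim (FP.<-asym c<a (step⇒< {a} {c} {R} p (NP.≤-<-trans z≤n q)))

  Barrier-step : ∀ U {a c R y} → k ≤ℕ between a c R → Barrier (U ++ a ∷ c ∷ R) y → Barrier (U ++ c ∷ a ∷ R) y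
  Barrier-step [] {a} {c} {R} p (inj₁ (refl , q)) = ⊥-elim (left-not-barrier′ {a} {c} {R} p q)
  Barrier-step [] {a} {c} {R} p (inj₂ (inj₁ (refl , q))) = inj₁ (refl , right-barrier⁺ {a} {c} {R} p q)
  Barrier-step [] p (inj₂ (inj₂ b)) = inj₂ (inj₂ b)
  Barrier-step (_ ∷ U) {a} {c} {R} {y} p (inj₁ (e , q)) = inj₁ (e , subst (_<ℕ k) (above-swap y U a c R) q)
  Barrier-step (_ ∷ U) p (inj₂ b) = inj₂ (Barrier-step U p b)

  Barrier-step⁻ : ∀ U {a c R y} → k ≤ℕ between a c R → Barrier (U ++ c ∷ a ∷ R) y → Barrier (U ++ a ∷ c ∷ R) y
  Barrier-step⁻ [] {a} {c} {R} p (inj₁ (refl , q)) = inj₂ (inj₁ (refl , above<k-tail {c} {a} {R} q))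
  Barrier-step⁻ [] {a} {c} {R} p (inj₂ (inj₁ (refl , q))) = ⊥-elim (left-not-barrier {a} {c} {R} p q)
  Barrier-step⁻ [] p (inj₂ (inj₂ b)) = inj₂ (inj₂ b)
  Barrier-step⁻ (_ ∷ U) {a} {c} {R} {y} p (inj₁ (e , q)) = inj₁ (e , subst (_<ℕ k) (sym (above-swap y U a c R)) q)
  Barrier-step⁻ (_ ∷ U) p (inj₂ b) = inj₂ (Barrier-step⁻ U p b)

  Barrier-resp-Sym : ∀ {u v y} → Sym u v → Barrier u y → Barrier v y
  Barrier-resp-Sym (fwd (swap U a c R p)) = Barrier-step U p
  Barrier-resp-Sym (bwd (swap U a c R p)) = Barrier-step⁻ U p

  Barrier-resp-≈ : ∀ {u v y} → u ≈ v → Barrier u y → Barrier v y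
  Barrier-resp-≈ ε b = b
  Barrier-resp-≈ (s ◅ q) b = Barrier-resp-≈ q (Barrier-resp-Sym s b)

  -- A barrier s keeps its position relative to every larger letter x: the
  -- only step that could swap them would have s as its left letter.
  barrier-first-Sym : ∀ {u v s x} → Sym u v → Unique u → Barrier u s → s <F x → Bef u s x → Bef v s x
  barrier-first-Sym (fwd (swap U a c R p)) u! b _ bf =
    Bef-swap U bf λ { (refl , refl) → left-not-barrier′ {a} {c} {R} p (Barrier-at U u! b) }
  barrier-first-Sym (bwd (swap U a c R p)) _ b s<x bf =
    Bef-swap U bf λ { (refl , refl) → FP.<-asym s<x (step⇒< {a} {c} {R} p (Barrier⇒k>0 b)) }

  barrier-last-Sym : ∀ {u v s x} → Sym u v → Unique u → Barrier u s → s <F x → Bef u x s → Bef v x s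
  barrier-last-Sym (fwd (swap U a c R p)) _ b s<x bf =
    Bef-swap U bf λ { (refl , refl) → FP.<-asym s<x (step⇒< {a} {c} {R} p (Barrier⇒k>0 b)) }
  barrier-last-Sym (bwd (swap U a c R p)) u! b _ bf =
    Bef-swap U bf λ { (refl , refl) → left-not-barrier {a} {c} {R} p (Barrier-at (U ++ [ c ]) (subst Unique reassoc u!) (subst (λ w → Barrier w _) reassoc b)) }
    where
    reassoc : U ++ c ∷ a ∷ R ≡ (U ++ [ c ]) ++ a ∷ R
    reassoc = sym (++-assoc U [ c ] (a ∷ R))

  barrier-first-≈ : ∀ {u v s x} → u ≈ v → Unique u → Barrier u s → s <F x → Bef u s x → Bef v s x
  barrier-first-≈ ε _ _ _ bf = bf
  barrier-first-≈ (st ◅ q) u! b s<x bf =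
    barrier-first-≈ q (Unique-resp-Sym st u!) (Barrier-resp-Sym st b) s<x (barrier-first-Sym st u! b s<x bf)

  barrier-last-≈ : ∀ {u v s x} → u ≈ v → Unique u → Barrier u s → s <F x → Bef u x s → Bef v x s
  barrier-last-≈ ε _ _ _ bf = bf
  barrier-last-≈ (st ◅ q) u! b s<x bf =
    barrier-last-≈ q (Unique-resp-Sym st u!) (Barrier-resp-Sym st b) s<x (barrier-last-Sym st u! b s<x bf)

  -- If u ≈ v and u ≼ v, a barrier y of u that precedes x still precedes x
  -- in v: for x > y by barrier invariance, for x < y because the
  -- coinversion (x , y) of u persists in v.
  barrier-before-≼ : ∀ {u v y x} → u ≈ v → u ≼ v → Unique u → Barrier u y → Bef u y x → Bef v y x
  barrier-before-≼ {y = y} {x} q u≼v u! b bf with FP.<-cmp y x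
  ... | tri< y<x _ _ = barrier-first-≈ q u! b y<x bf
  ... | tri≈ _ refl _ = ⊥-elim (Bef-irrefl u! bf)
  ... | tri> _ _ x<y = u≼v x y x<y bf

  record IntervalClass (j : ℕ) (σ : Word) : Set where
    field
      lo hi    : Word
      lo-perm  : PermOf j lo
      hi-perm  : PermOf j hi
      sound    : ∀ ρ → PermOf j ρ → σ ≈ ρ → lo ≼ ρ × ρ ≼ hi
      complete : ∀ ρ → PermOf j ρ → lo ≼ ρ × ρ ≼ hi → σ ≈ ρ

module RemoveMax (k n : ℕ) (m : Fin n) where
  open Words n
  open Twist k n

  erase : Word → Word
  erase [] = []
  erase (x ∷ w) with x ≟ m
  ... | yes _ = erase w
  ... | no _ = x ∷ erase w

  after : Word → Word
  after [] = []
  after (x ∷ w) with x ≟ m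
  ... | yes _ = w
  ... | no _ = after w

  -- A target is a letter, or nothing for "the end of the word".
  -- firstBarrier V : the first letter of V with fewer than k larger letters
  -- to its right (nothing if there is none).
  firstBarrier : Word → Maybe (Fin n)
  firstBarrier [] = nothing
  firstBarrier (x ∷ V) with above x V ℕ.<? k
  ... | yes _ = just x
  ... | no _ = firstBarrier V

  nextBarrier : Word → Maybe (Fin n)
  nextBarrier w = firstBarrier (after w)

  insertBefore : Maybe (Fin n) → Word → Word
  insertBefore t [] = m ∷ []
  insertBefore nothing (x ∷ u) = x ∷ insertBefore nothing u
  insertBefore (just t) (x ∷ u) with x ≟ t
  ... | yes _ = m ∷ x ∷ u
  ... | no _ = x ∷ insertBefore (just t) u

  Misses : Maybe (Fin n) → Fin n → Set
  Misses nothing _ = ⊤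
  Misses (just t) x = x ≢ t

  TargetBarrier : Maybe (Fin n) → Word → Set
  TargetBarrier nothing _ = ⊤
  TargetBarrier (just t) u = Barrier u t

  BeforeTarget : Word → Fin n → Maybe (Fin n) → Set
  BeforeTarget _ _ nothing = ⊤
  BeforeTarget u y (just t) = Bef u y t

  erase-≡ : ∀ {x} w → x ≡ m → erase (x ∷ w) ≡ erase w
  erase-≡ w refl with m ≟ m
  ... | yes _ = refl
  ... | no m≢m = ⊥-elim (m≢m refl)

  erase-≢ : ∀ {x} w → x ≢ m → erase (x ∷ w) ≡ x ∷ erase w
  erase-≢ {x} w x≢m with x ≟ m
  ... | yes x≡m = ⊥-elim (x≢m x≡m)
  ... | no _ = refl

  after-≡ : ∀ {x} w → x ≡ m → after (x ∷ w) ≡ w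
  after-≡ w refl with m ≟ m
  ... | yes _ = refl
  ... | no m≢m = ⊥-elim (m≢m refl)

  after-≢ : ∀ {x} w → x ≢ m → after (x ∷ w) ≡ after w
  after-≢ {x} w x≢m with x ≟ m
  ... | yes x≡m = ⊥-elim (x≢m x≡m)
  ... | no _ = refl

  firstBarrier-yes : ∀ {x} V → above x V <ℕ k → firstBarrier (x ∷ V) ≡ just x
  firstBarrier-yes {x} V p with above x V ℕ.<? k
  ... | yes _ = refl
  ... | no ¬p = ⊥-elim (¬p p)

  firstBarrier-no : ∀ {x} V → ¬ (above x V <ℕ k) → firstBarrier (x ∷ V) ≡ firstBarrier V
  firstBarrier-no {x} V ¬p with above x V ℕ.<? k
  ... | yes p = ⊥-elim (¬p p)
  ... | no _ = refl

  insert-hit : ∀ {x t} u → x ≡ t → insertBefore (just t) (x ∷ u) ≡ m ∷ x ∷ u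
  insert-hit {x} {t} u x≡t with x ≟ t
  ... | yes _ = refl
  ... | no x≢t = ⊥-elim (x≢t x≡t)

  insert-miss : ∀ {x} t u → Misses t x → insertBefore t (x ∷ u) ≡ x ∷ insertBefore t u
  insert-miss nothing u _ = refl
  insert-miss {x} (just t) u x≢t with x ≟ t
  ... | yes x≡t = ⊥-elim (x≢t x≡t)
  ... | no _ = refl

  insert-split : ∀ t u → Σ Word λ X → Σ Word λ Y → u ≡ X ++ Y × insertBefore t u ≡ X ++ m ∷ Y
  insert-split t [] = [] , [] , refl , refl
  insert-split nothing (x ∷ u) with insert-split nothing u
  ... | X , Y , refl , e = x ∷ X , Y , refl , cong (x ∷_) e
  insert-split (just t) (x ∷ u) with x ≟ t
  ... | yes _ = [] , x ∷ u , refl , refl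
  ... | no _ with insert-split (just t) u
  ...   | X , Y , refl , e = x ∷ X , Y , refl , cong (x ∷_) e

  erase-++ : ∀ U Z → erase (U ++ Z) ≡ erase U ++ erase Z
  erase-++ [] Z = refl
  erase-++ (x ∷ U) Z with x ≟ m
  ... | yes _ = erase-++ U Z
  ... | no _ = cong (x ∷_) (erase-++ U Z)

  erase-fresh : ∀ V → m ∉ V → erase V ≡ V
  erase-fresh [] _ = refl
  erase-fresh (x ∷ V) m∉ = trans (erase-≢ V (λ e → m∉ (here (sym e)))) (cong (x ∷_) (erase-fresh V (λ p → m∉ (there p))))

  erase-insert : ∀ X Y → m ∉ X ++ Y → erase (X ++ m ∷ Y) ≡ X ++ Y
  erase-insert X Y m∉ = begin
    erase (X ++ m ∷ Y)        ≡⟨ erase-++ X (m ∷ Y) ⟩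
    erase X ++ erase (m ∷ Y)  ≡⟨ cong (erase X ++_) (erase-≡ Y refl) ⟩
    erase X ++ erase Y        ≡⟨ cong₂ _++_ (erase-fresh X (proj₁ (∉-++ X m∉))) (erase-fresh Y (proj₂ (∉-++ X m∉))) ⟩
    X ++ Y                    ∎
    where open ≡.≡-Reasoning

  erase-⊆ : ∀ w {x} → x ∈ erase w → x ∈ w
  erase-⊆ (z ∷ w) p with z ≟ m
  ... | yes _ = there (erase-⊆ w p)
  erase-⊆ (z ∷ w) (here e) | no _ = here e
  erase-⊆ (z ∷ w) (there p) | no _ = there (erase-⊆ w p)

  m∉erase : ∀ w → m ∉ erase w
  m∉erase (z ∷ w) p with z ≟ m
  ... | yes _ = m∉erase w p
  m∉erase (z ∷ w) (here e) | no z≢m = z≢m (sym e)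
  m∉erase (z ∷ w) (there p) | no _ = m∉erase w p

  ∈-erase⇒≢m : ∀ w {y} → y ∈ erase w → y ≢ m
  ∈-erase⇒≢m w p refl = m∉erase w p

  ∈-erase : ∀ w {x} → x ∈ w → x ≢ m → x ∈ erase w
  ∈-erase (_ ∷ w) (here refl) x≢m rewrite erase-≢ w x≢m = here refl
  ∈-erase (z ∷ w) (there p) x≢m with z ≟ m
  ... | yes _ = ∈-erase w p x≢m
  ... | no _ = there (∈-erase w p x≢m)

  Unique-erase : ∀ w → Unique w → Unique (erase w)
  Unique-erase [] _ = []
  Unique-erase (z ∷ w) (z≢ ∷ u) with z ≟ m
  ... | yes _ = Unique-erase w u
  ... | no _ = All.tabulate (λ p → All.lookup z≢ (erase-⊆ w p)) ∷ Unique-erase w u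

  after-⊆ : ∀ w {t} → t ∈ after w → t ∈ w
  after-⊆ (x ∷ w) p with x ≟ m
  ... | yes _ = there p
  ... | no _ = there (after-⊆ w p)

  Bef-erase : ∀ {w x y} → Bef w x y → x ≢ m → y ≢ m → Bef (erase w) x y
  Bef-erase {_ ∷ w} (now p) x≢m y≢m rewrite erase-≢ w x≢m = now (∈-erase w p y≢m)
  Bef-erase {z ∷ _} (later b) x≢m y≢m with z ≟ m
  ... | yes _ = Bef-erase b x≢m y≢m
  ... | no _ = later (Bef-erase b x≢m y≢m)

  Bef-erase⁻ : ∀ w {x y} → Bef (erase w) x y → Bef w x y
  Bef-erase⁻ (z ∷ w) b with z ≟ m
  ... | yes _ = later (Bef-erase⁻ w b)
  Bef-erase⁻ (z ∷ w) (now p) | no _ = now (erase-⊆ w p)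
  Bef-erase⁻ (z ∷ w) (later b) | no _ = later (Bef-erase⁻ w b)

  BeforeTarget-tail : ∀ {x u y} t → BeforeTarget (x ∷ u) y t → y ≢ x → BeforeTarget u y t
  BeforeTarget-tail nothing _ _ = tt
  BeforeTarget-tail (just _) b y≢x = Bef-tail b y≢x

  BeforeTarget-cons : ∀ {x u y} t → BeforeTarget u y t → BeforeTarget (x ∷ u) y t
  BeforeTarget-cons nothing _ = tt
  BeforeTarget-cons (just _) b = later b

  firstBarrier-∈ : ∀ V {t} → firstBarrier V ≡ just t → t ∈ V
  firstBarrier-∈ (x ∷ V) e with above x V ℕ.<? k
  firstBarrier-∈ (x ∷ V) refl | yes _ = here refl
  ... | no _ = there (firstBarrier-∈ V e)

  firstBarrier-Barrier : ∀ V {t} → firstBarrier V ≡ just t → Barrier V t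
  firstBarrier-Barrier (x ∷ V) e with above x V ℕ.<? k
  firstBarrier-Barrier (x ∷ V) refl | yes q = inj₁ (refl , q)
  ... | no _ = inj₂ (firstBarrier-Barrier V e)

  misses-firstBarrier : ∀ {y V} → All (y ≢_) V → ∀ t → firstBarrier V ≡ t → Misses t y
  misses-firstBarrier _ nothing _ = tt
  misses-firstBarrier {V = V} y≢ (just _) e refl = All≢⇒∉ y≢ (firstBarrier-∈ V e)

  misses-nextBarrier : ∀ {x w} → All (x ≢_) w → ∀ t → nextBarrier w ≡ t → Misses t x
  misses-nextBarrier _ nothing _ = tt
  misses-nextBarrier {w = w} x≢ (just _) e refl = All≢⇒∉ x≢ (after-⊆ w (firstBarrier-∈ (after w) e))

  Barrier-after : ∀ w {t} → Unique w → Barrier (after w) t → Barrier (erase w) t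
  Barrier-after (x ∷ w) (x≢ ∷ u) b with x ≟ m
  ... | yes refl rewrite erase-fresh w (All≢⇒∉ x≢) = b
  ... | no _ = inj₂ (Barrier-after w u b)

  nextBarrier-ok : ∀ w → Unique w → TargetBarrier (nextBarrier w) (erase w)
  nextBarrier-ok w u = go (nextBarrier w) refl
    where
    go : ∀ t → nextBarrier w ≡ t → TargetBarrier t (erase w)
    go nothing _ = tt
    go (just t) e = Barrier-after w u (firstBarrier-Barrier (after w) e)

  ≤m⇒≯m : ∀ {c : Fin n} → c ≤F m → ¬ (m <F c)
  ≤m⇒≯m c≤m m<c = NP.<-irrefl refl (NP.<-≤-trans m<c c≤m)

  between-erase : ∀ a c R → ¬ (m <F c) → between a c (erase R) ≡ between a c R
  between-erase a c [] _ = refl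
  between-erase a c (y ∷ R) m≮c with y ≟ m
  between-erase a c (y ∷ R) m≮c | yes refl with a <? y | y <? c
  ... | yes _ | yes m<c = ⊥-elim (m≮c m<c)
  ... | yes _ | no _ = between-erase a c R m≮c
  ... | no _ | _ = between-erase a c R m≮c
  between-erase a c (y ∷ R) m≮c | no _ with a <? y | y <? c
  ... | yes _ | yes _ = cong suc (between-erase a c R m≮c)
  ... | yes _ | no _ = between-erase a c R m≮c
  ... | no _ | _ = between-erase a c R m≮c

  -- A step either involves m, and then disappears when m is erased, or it
  -- does not, and then remains a legal step (erasing m < c does not change
  -- the count between a and c).
  erase-Step : ∀ U a c R → All (_≤F m) (U ++ a ∷ c ∷ R) → k ≤ℕ between a c R →
    (erase (U ++ a ∷ c ∷ R) ≡ erase (U ++ c ∷ a ∷ R)) ⊎ Step (erase (U ++ a ∷ c ∷ R)) (erase (U ++ c ∷ a ∷ R))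
  erase-Step U a c R al p rewrite erase-++ U (a ∷ c ∷ R) | erase-++ U (c ∷ a ∷ R) = go (a ≟ m) (c ≟ m)
    where
    c≤m : c ≤F m
    c≤m = All.lookup al (MP.∈-++⁺ʳ U (there (here refl)))
    go : Dec (a ≡ m) → Dec (c ≡ m) → (erase U ++ erase (a ∷ c ∷ R) ≡ erase U ++ erase (c ∷ a ∷ R))
         ⊎ Step (erase U ++ erase (a ∷ c ∷ R)) (erase U ++ erase (c ∷ a ∷ R))
    go (yes a≡m) (yes c≡m) = inj₁ (cong (erase U ++_) (begin
      erase (a ∷ c ∷ R)  ≡⟨ erase-≡ (c ∷ R) a≡m ⟩
      erase (c ∷ R)      ≡⟨ erase-≡ R c≡m ⟩
      erase R            ≡⟨ erase-≡ R a≡m ⟨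
      erase (a ∷ R)      ≡⟨ erase-≡ (a ∷ R) c≡m ⟨
      erase (c ∷ a ∷ R)  ∎))
      where open ≡.≡-Reasoning
    go (yes a≡m) (no c≢m) = inj₁ (cong (erase U ++_) (begin
      erase (a ∷ c ∷ R)  ≡⟨ erase-≡ (c ∷ R) a≡m ⟩
      erase (c ∷ R)      ≡⟨ erase-≢ R c≢m ⟩
      c ∷ erase R        ≡⟨ cong (c ∷_) (erase-≡ R a≡m) ⟨
      c ∷ erase (a ∷ R)  ≡⟨ erase-≢ (a ∷ R) c≢m ⟨
      erase (c ∷ a ∷ R)  ∎))
      where open ≡.≡-Reasoning
    go (no a≢m) (yes c≡m) = inj₁ (cong (erase U ++_) (begin
      erase (a ∷ c ∷ R)  ≡⟨ erase-≢ (c ∷ R) a≢m ⟩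
      a ∷ erase (c ∷ R)  ≡⟨ cong (a ∷_) (erase-≡ R c≡m) ⟩
      a ∷ erase R        ≡⟨ erase-≢ R a≢m ⟨
      erase (a ∷ R)      ≡⟨ erase-≡ (a ∷ R) c≡m ⟨
      erase (c ∷ a ∷ R)  ∎))
      where open ≡.≡-Reasoning
    go (no a≢m) (no c≢m)
      rewrite erase-≢ (c ∷ R) a≢m | erase-≢ R c≢m | erase-≢ (a ∷ R) c≢m | erase-≢ R a≢m =
      inj₂ (swap (erase U) a c (erase R) (subst (k ≤ℕ_) (sym (between-erase a c R (≤m⇒≯m c≤m))) p))

  erase-resp-≈ : ∀ {u v} → u ≈ v → All (_≤F m) u → erase u ≈ erase v
  erase-resp-≈ ε _ = ε
  erase-resp-≈ (fwd (swap U a c R p) ◅ q) al with erase-Step U a c R al p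
  ... | inj₁ e = subst (_≈ _) (sym e) (erase-resp-≈ q (All-swap U a c R al))
  ... | inj₂ s = fwd s ◅ erase-resp-≈ q (All-swap U a c R al)
  erase-resp-≈ (bwd (swap U a c R p) ◅ q) al with erase-Step U a c R (All-swap U c a R al) p
  ... | inj₁ e = subst (_≈ _) e (erase-resp-≈ q (All-swap U c a R al))
  ... | inj₂ s = bwd s ◅ erase-resp-≈ q (All-swap U c a R al)

  firstBarrier-Step : ∀ X {a c R} → k ≤ℕ between a c R → firstBarrier (X ++ a ∷ c ∷ R) ≡ firstBarrier (X ++ c ∷ a ∷ R)
  firstBarrier-Step [] {a} {c} {R} p =
    trans (firstBarrier-no (c ∷ R) (left-not-barrier′ {a} {c} {R} p)) (go (above c (a ∷ R) ℕ.<? k))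
    where
    go : Dec (above c (a ∷ R) <ℕ k) → firstBarrier (c ∷ R) ≡ firstBarrier (c ∷ a ∷ R)
    go (yes q) = trans (firstBarrier-yes R (above<k-tail {c} {a} {R} q)) (sym (firstBarrier-yes (a ∷ R) q))
    go (no ¬q) = trans (firstBarrier-no R (λ q → ¬q (right-barrier⁺ {a} {c} {R} p q)))
                   (sym (trans (firstBarrier-no (a ∷ R) ¬q) (firstBarrier-no R (left-not-barrier {a} {c} {R} p))))
  firstBarrier-Step (x ∷ X) {a} {c} {R} p = go (above x (X ++ a ∷ c ∷ R) ℕ.<? k)
    where
    e = above-swap x X a c R
    go : Dec (above x (X ++ a ∷ c ∷ R) <ℕ k) → firstBarrier (x ∷ X ++ a ∷ c ∷ R) ≡ firstBarrier (x ∷ X ++ c ∷ a ∷ R)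
    go (yes q) = trans (firstBarrier-yes _ q) (sym (firstBarrier-yes _ (subst (_<ℕ k) e q)))
    go (no ¬q) = trans (firstBarrier-no _ ¬q)
                   (trans (firstBarrier-Step X p) (sym (firstBarrier-no _ (λ q → ¬q (subst (_<ℕ k) (sym e) q)))))

  -- A legal step preserves the next barrier after m: steps away from m act
  -- inside the part after m or leave it alone, and a step moving m past a
  -- smaller letter a skips no barrier, since a is not one.
  nextBarrier-Step : ∀ U a c R → All (_≤F m) (U ++ a ∷ c ∷ R) → k ≤ℕ between a c R →
    nextBarrier (U ++ a ∷ c ∷ R) ≡ nextBarrier (U ++ c ∷ a ∷ R)
  nextBarrier-Step (x ∷ U) a c R al p = go (x ≟ m)
    where
    go : Dec (x ≡ m) → nextBarrier (x ∷ U ++ a ∷ c ∷ R) ≡ nextBarrier (x ∷ U ++ c ∷ a ∷ R)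
    go (yes x≡m) = trans (cong firstBarrier (after-≡ _ x≡m))
                     (trans (firstBarrier-Step U p) (sym (cong firstBarrier (after-≡ _ x≡m))))
    go (no x≢m) = trans (cong firstBarrier (after-≢ _ x≢m))
                    (trans (nextBarrier-Step U a c R (All.tail al) p) (sym (cong firstBarrier (after-≢ _ x≢m))))
  nextBarrier-Step [] a c R al p = go (a ≟ m) (c ≟ m)
    where
    c≤m : c ≤F m
    c≤m = All.lookup al (there (here refl))
    go : Dec (a ≡ m) → Dec (c ≡ m) → nextBarrier (a ∷ c ∷ R) ≡ nextBarrier (c ∷ a ∷ R)
    go (yes a≡m) (yes c≡m) = trans (cong firstBarrier (after-≡ _ a≡m))
      (trans (cong (λ z → firstBarrier (z ∷ R)) (trans c≡m (sym a≡m))) (sym (cong firstBarrier (after-≡ _ c≡m))))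
    go (yes a≡m) (no c≢m) = trans (cong firstBarrier (after-≡ _ a≡m))
      (trans (firstBarrier-no R (λ q → ≤m⇒≯m c≤m (subst (_<F c) a≡m (step⇒< {a} {c} {R} p (NP.≤-<-trans z≤n q)))))
      (sym (trans (cong firstBarrier (after-≢ _ c≢m)) (cong firstBarrier (after-≡ _ a≡m)))))
    go (no a≢m) (yes c≡m) = trans (cong firstBarrier (trans (after-≢ _ a≢m) (after-≡ _ c≡m)))
      (sym (trans (cong firstBarrier (after-≡ _ c≡m)) (firstBarrier-no R (left-not-barrier {a} {c} {R} p))))
    go (no a≢m) (no c≢m) = trans (cong firstBarrier (trans (after-≢ _ a≢m) (after-≢ _ c≢m)))
      (sym (cong firstBarrier (trans (after-≢ _ c≢m) (after-≢ _ a≢m))))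

  nextBarrier-resp-≈ : ∀ {u v} → u ≈ v → All (_≤F m) u → nextBarrier u ≡ nextBarrier v
  nextBarrier-resp-≈ ε _ = refl
  nextBarrier-resp-≈ (fwd (swap U a c R p) ◅ q) al =
    trans (nextBarrier-Step U a c R al p) (nextBarrier-resp-≈ q (All-swap U a c R al))
  nextBarrier-resp-≈ (bwd (swap U a c R p) ◅ q) al =
    trans (sym (nextBarrier-Step U a c R (All-swap U c a R al) p)) (nextBarrier-resp-≈ q (All-swap U c a R al))

  between-insert : ∀ a c t R → between a c R ≤ℕ between a c (insertBefore t R)
  between-insert a c t R with insert-split t R
  ... | X , Y , refl , e rewrite e | between-++ a c X Y | between-++ a c X (m ∷ Y) =
    NP.+-monoʳ-≤ (between a c X) (between-cons≥ a c m Y)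

  TargetBarrier-resp-Sym : ∀ t {u v} → Sym u v → TargetBarrier t u → TargetBarrier t v
  TargetBarrier-resp-Sym nothing _ _ = tt
  TargetBarrier-resp-Sym (just _) s b = Barrier-resp-Sym s b

  TargetBarrier-resp-≈ : ∀ t {u v} → u ≈ v → TargetBarrier t u → TargetBarrier t v
  TargetBarrier-resp-≈ t ε ok = ok
  TargetBarrier-resp-≈ t (s ◅ q) ok = TargetBarrier-resp-≈ t q (TargetBarrier-resp-Sym t s ok)

  -- Inserting m before a barrier target commutes with a step: m can only
  -- land between a and c when c is the target, and then m c and a m are
  -- legal steps (the letters between a and c also lie between a and m).
  insert-Step : ∀ t U a c R → k ≤ℕ between a c R → All (_≤F m) (U ++ a ∷ c ∷ R) → Unique (U ++ a ∷ c ∷ R) →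
    TargetBarrier t (U ++ a ∷ c ∷ R) → insertBefore t (U ++ a ∷ c ∷ R) ≈ insertBefore t (U ++ c ∷ a ∷ R)
  insert-Step nothing (x ∷ U) a c R p al (_ ∷ u) _ = ≈-cons x (insert-Step nothing U a c R p (All.tail al) u tt)
  insert-Step (just t) (x ∷ U) a c R p al (_ ∷ u) ok with x ≟ t
  ... | yes _ = Step⇒≈ (swap (m ∷ x ∷ U) a c R p)
  ... | no x≢t with ok
  ...   | inj₁ (x≡t , _) = ⊥-elim (x≢t x≡t)
  ...   | inj₂ b = ≈-cons x (insert-Step (just t) U a c R p (All.tail al) u b)
  insert-Step nothing [] a c R p _ _ _ =
    Step⇒≈ (swap [] a c (insertBefore nothing R) (NP.≤-trans p (between-insert a c nothing R)))
  insert-Step (just t) [] a c R p al (a≢ ∷ _) ok = go (a ≟ t) (c ≟ t)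
    where
    a-not-target : a ≡ t → Barrier (a ∷ c ∷ R) t → ⊥
    a-not-target refl (inj₁ (_ , q)) = left-not-barrier′ {a} {c} {R} p q
    a-not-target refl (inj₂ b) = All≢⇒∉ a≢ (Barrier⇒∈ b)
    go : Dec (a ≡ t) → Dec (c ≡ t) → insertBefore (just t) (a ∷ c ∷ R) ≈ insertBefore (just t) (c ∷ a ∷ R)
    go (yes a≡t) _ = ⊥-elim (a-not-target a≡t ok)
    go (no a≢t) (yes c≡t)
      rewrite insert-miss (just t) (c ∷ R) a≢t | insert-hit R c≡t | insert-hit (a ∷ R) c≡t =
      fwd (swap [] a m (c ∷ R) (NP.≤-trans p (NP.≤-trans (between-monoʳ a c m R (All.lookup al (there (here refl))))
                                                        (between-cons≥ a m c R))))
      ◅ Step⇒≈ (swap [ m ] a c R p)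
    go (no a≢t) (no c≢t)
      rewrite insert-miss (just t) (c ∷ R) a≢t | insert-miss (just t) R c≢t
            | insert-miss (just t) (a ∷ R) c≢t | insert-miss (just t) R a≢t =
      Step⇒≈ (swap [] a c (insertBefore (just t) R) (NP.≤-trans p (between-insert a c (just t) R)))

  insert-resp-≈ : ∀ t {u v} → u ≈ v → All (_≤F m) u → Unique u → TargetBarrier t u → insertBefore t u ≈ insertBefore t v
  insert-resp-≈ t ε _ _ _ = ε
  insert-resp-≈ t (st@(fwd (swap U a c R p)) ◅ q) al u ok =
    insert-Step t U a c R p al u ok
    ◅◅ insert-resp-≈ t q (All-swap U a c R al) (Unique-swap U a c R u) (TargetBarrier-resp-Sym t st ok)
  insert-resp-≈ t (st@(bwd (swap U a c R p)) ◅ q) al u ok =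
    ≈-sym (insert-Step t U a c R p (All-swap U c a R al) (Unique-swap U c a R u) (TargetBarrier-resp-Sym t st ok))
    ◅◅ insert-resp-≈ t q (All-swap U c a R al) (Unique-swap U c a R u) (TargetBarrier-resp-Sym t st ok)

  above≤between : ∀ y V → All (_<F m) V → above y V ≤ℕ between y m V
  above≤between y [] _ = z≤n
  above≤between y (x ∷ V) (x<m ∷ al) with y <? x | x <? m
  ... | yes _ | yes _ = s≤s (above≤between y V al)
  ... | yes _ | no x≮m = ⊥-elim (x≮m x<m)
  ... | no _ | _ = above≤between y V al

  -- m can be moved right past every letter that is not a barrier, so it
  -- travels to the first barrier to its right.
  push-m : ∀ V → Unique V → All (_<F m) V → (m ∷ V) ≈ insertBefore (firstBarrier V) V
  push-m [] _ _ = ε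
  push-m (y ∷ V) (y≢ ∷ u) (y<m ∷ al) = go (above y V ℕ.<? k)
    where
    go : Dec (above y V <ℕ k) → (m ∷ y ∷ V) ≈ insertBefore (firstBarrier (y ∷ V)) (y ∷ V)
    go (yes q) rewrite firstBarrier-yes V q | insert-hit V (refl {x = y}) = ε
    go (no ¬q) rewrite firstBarrier-no V ¬q | insert-miss (firstBarrier V) V (misses-firstBarrier y≢ (firstBarrier V) refl) =
      bwd (swap [] y m V (NP.≤-trans (NP.≮⇒≥ ¬q) (above≤between y V al))) ◅ ≈-cons y (push-m V u al)

  <m-of-≤m : ∀ {V} → All (_≤F m) V → m ∉ V → All (_<F m) V
  <m-of-≤m [] _ = []
  <m-of-≤m (x≤m ∷ al) m∉ = FP.≤∧≢⇒< x≤m (λ e → m∉ (here (sym e))) ∷ <m-of-≤m al (λ p → m∉ (there p))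

  normal-form : ∀ ρ → Unique ρ → m ∈ ρ → All (_≤F m) ρ → ρ ≈ insertBefore (nextBarrier ρ) (erase ρ)
  normal-form (x ∷ ρ) (x≢ ∷ u) m∈ (_ ∷ al) = go (x ≟ m)
    where
    go : Dec (x ≡ m) → (x ∷ ρ) ≈ insertBefore (nextBarrier (x ∷ ρ)) (erase (x ∷ ρ))
    go (yes refl) rewrite after-≡ ρ refl | erase-≡ ρ refl | erase-fresh ρ (All≢⇒∉ x≢) =
      push-m ρ u (<m-of-≤m al (All≢⇒∉ x≢))
    go (no x≢m) rewrite after-≢ ρ x≢m | erase-≢ ρ x≢m
                      | insert-miss (nextBarrier ρ) (erase ρ) (misses-nextBarrier x≢ (nextBarrier ρ) refl) =
      ≈-cons x (normal-form ρ u (m∈-tail m∈) al)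
      where
      m∈-tail : m ∈ x ∷ ρ → m ∈ ρ
      m∈-tail (here e) = ⊥-elim (x≢m (sym e))
      m∈-tail (there p) = p

  invariants⇒≈ : ∀ {σ ρ} → Unique σ → m ∈ σ → All (_≤F m) σ → Unique ρ → m ∈ ρ → All (_≤F m) ρ →
    erase σ ≈ erase ρ → nextBarrier σ ≡ nextBarrier ρ → σ ≈ ρ
  invariants⇒≈ {σ} {ρ} uσ mσ aσ uρ mρ aρ d e =
    normal-form σ uσ mσ aσ
    ◅◅ insert-resp-≈ (nextBarrier σ) d (All.tabulate (λ p → All.lookup aσ (erase-⊆ σ p))) (Unique-erase σ uσ) (nextBarrier-ok σ uσ)
    ◅◅ subst (λ t → insertBefore t (erase ρ) ≈ ρ) (sym e) (≈-sym (normal-form ρ uρ mρ aρ))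

  m-before-nextBarrier : ∀ ρ {t} → nextBarrier ρ ≡ just t → m ∈ ρ → Bef ρ m t
  m-before-nextBarrier (x ∷ ρ) e m∈ with x ≟ m
  ... | yes refl = now (firstBarrier-∈ ρ e)
  ... | no x≢m with m∈
  ...   | here m≡x = ⊥-elim (x≢m (sym m≡x))
  ...   | there p = later (m-before-nextBarrier ρ e p)

  firstBarrier-first : ∀ V {y} → Unique V → Barrier V y → BeforeTarget V y (firstBarrier V) → ⊥
  firstBarrier-first (x ∷ V) (x≢ ∷ u) b bt with above x V ℕ.<? k
  firstBarrier-first (x ∷ V) (x≢ ∷ u) b (now p) | yes _ = All≢⇒∉ x≢ p
  firstBarrier-first (x ∷ V) (x≢ ∷ u) b (later b′) | yes _ = All≢⇒∉ x≢ (Bef-∈ʳ b′)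
  firstBarrier-first (x ∷ V) (x≢ ∷ u) (inj₁ (refl , q)) _ | no ¬q = ¬q q
  firstBarrier-first (x ∷ V) (x≢ ∷ u) (inj₂ b) bt | no _ =
    firstBarrier-first V u b (BeforeTarget-tail (firstBarrier V) bt (λ { refl → All≢⇒∉ x≢ (Barrier⇒∈ b) }))

  barrier-before-m : ∀ ρ {y} → Unique ρ → m ∈ ρ → Barrier (erase ρ) y →
    BeforeTarget (erase ρ) y (nextBarrier ρ) → Bef ρ y m
  barrier-before-m (x ∷ ρ) (x≢ ∷ u) m∈ b bt with x ≟ m
  ... | yes refl rewrite erase-fresh ρ (All≢⇒∉ x≢) = ⊥-elim (firstBarrier-first ρ u b bt)
  ... | no x≢m with m∈
  ...   | here m≡x = ⊥-elim (x≢m (sym m≡x))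
  ...   | there p with b
  ...     | inj₁ (refl , _) = now p
  ...     | inj₂ b′ = later (barrier-before-m ρ u p b′
                        (BeforeTarget-tail (nextBarrier ρ) bt (λ { refl → All≢⇒∉ x≢ (erase-⊆ ρ (Barrier⇒∈ b′)) })))

  firstBarrier-unique : ∀ V t → Unique V → TargetBarrier t V → (∀ t′ → t ≡ just t′ → t′ ∈ V) →
    (∀ y → Barrier V y → BeforeTarget V y t → ⊥) → firstBarrier V ≡ t
  firstBarrier-unique [] nothing _ _ _ _ = refl
  firstBarrier-unique [] (just t′) _ _ t∈ _ with t∈ t′ refl
  ... | ()
  firstBarrier-unique (x ∷ V) t (x≢ ∷ u) ok t∈ none-before with above x V ℕ.<? k
  firstBarrier-unique (x ∷ V) nothing (x≢ ∷ u) ok t∈ none-before | yes q = ⊥-elim (none-before x (inj₁ (refl , q)) tt)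
  firstBarrier-unique (x ∷ V) (just t′) (x≢ ∷ u) ok t∈ none-before | yes q with t∈ t′ refl
  ... | here refl = refl
  ... | there p = ⊥-elim (none-before x (inj₁ (refl , q)) (now p))
  firstBarrier-unique (x ∷ V) t (x≢ ∷ u) ok t∈ none-before | no ¬q =
    firstBarrier-unique V t u (ok-tail t ok) t∈-tail (λ y b bt → none-before y (inj₂ b) (BeforeTarget-cons t bt))
    where
    ok-tail : ∀ t → TargetBarrier t (x ∷ V) → TargetBarrier t V
    ok-tail nothing _ = tt
    ok-tail (just _) (inj₁ (refl , q)) = ⊥-elim (¬q q)
    ok-tail (just _) (inj₂ b) = b
    target≢x : ∀ {t′} t → t ≡ just t′ → t′ ≡ x → TargetBarrier t (x ∷ V) → ⊥
    target≢x .(just _) refl refl (inj₁ (_ , q)) = ¬q q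
    target≢x .(just _) refl refl (inj₂ b) = All≢⇒∉ x≢ (Barrier⇒∈ b)
    t∈-tail : ∀ t′ → t ≡ just t′ → t′ ∈ V
    t∈-tail t′ e with t∈ t′ e
    ... | there p = p
    ... | here t′≡x = ⊥-elim (target≢x t e t′≡x ok)

  nextBarrier-unique : ∀ ρ t → Unique ρ → m ∈ ρ → TargetBarrier t (erase ρ) → (∀ t′ → t ≡ just t′ → Bef ρ m t′) →
    (∀ y → Barrier (erase ρ) y → BeforeTarget (erase ρ) y t → Bef ρ y m) → nextBarrier ρ ≡ t
  nextBarrier-unique (x ∷ ρ) t (x≢ ∷ u) m∈ ok m-first barriers-first with x ≟ m
  ... | yes refl rewrite erase-fresh ρ (All≢⇒∉ x≢) = firstBarrier-unique ρ t u ok t∈ none-before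
    where
    t∈ : ∀ t′ → t ≡ just t′ → t′ ∈ ρ
    t∈ t′ e with m-first t′ e
    ... | now p = p
    ... | later b = ⊥-elim (All≢⇒∉ x≢ (Bef-∈ˡ b))
    none-before : ∀ y → Barrier ρ y → BeforeTarget ρ y t → ⊥
    none-before y b bt with barriers-first y b bt
    ... | now p = All≢⇒∉ x≢ p
    ... | later b′ = All≢⇒∉ x≢ (Bef-∈ʳ b′)
  ... | no x≢m with m∈
  ...   | here m≡x = ⊥-elim (x≢m (sym m≡x))
  ...   | there p = nextBarrier-unique ρ t u p (ok-tail t ok m-first) m-first′ barriers-first′
    where
    ok-tail : ∀ t → TargetBarrier t (x ∷ erase ρ) → (∀ t′ → t ≡ just t′ → Bef (x ∷ ρ) m t′) → TargetBarrier t (erase ρ)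
    ok-tail nothing _ _ = tt
    ok-tail (just t′) (inj₁ (refl , _)) mf = ⊥-elim (All≢⇒∉ x≢ (Bef-∈ʳ (Bef-tail (mf t′ refl) (λ e → x≢m (sym e)))))
    ok-tail (just _) (inj₂ b) _ = b
    m-first′ : ∀ t′ → t ≡ just t′ → Bef ρ m t′
    m-first′ t′ e = Bef-tail (m-first t′ e) (λ e → x≢m (sym e))
    barriers-first′ : ∀ y → Barrier (erase ρ) y → BeforeTarget (erase ρ) y t → Bef ρ y m
    barriers-first′ y b bt =
      Bef-tail (barriers-first y (inj₂ b) (BeforeTarget-cons t bt)) (λ { refl → All≢⇒∉ x≢ (erase-⊆ ρ (Barrier⇒∈ b)) })

  -- "y precedes the barrier target t" is invariant: if y < t then t is a
  -- barrier before a larger letter, otherwise y is a barrier before t.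
  BeforeTarget-resp-≈ : ∀ {u v y} t → u ≈ v → Unique u → Barrier u y → TargetBarrier t u →
    BeforeTarget u y t → BeforeTarget v y t
  BeforeTarget-resp-≈ nothing _ _ _ _ _ = tt
  BeforeTarget-resp-≈ {y = y} (just t) q u b ok bt with FP.<-cmp y t
  ... | tri< y<t _ _ = barrier-first-≈ q u b y<t bt
  ... | tri≈ _ refl _ = ⊥-elim (Bef-irrefl u bt)
  ... | tri> _ _ t<y = barrier-last-≈ q u ok t<y bt

  -- In a word whose letters are at most m, m precedes only smaller letters,
  -- so the weak order splits into the order on the erased words and the set
  -- of letters preceded by m.
  m-before⇒< : ∀ {α x} → Unique α → All (_≤F m) α → Bef α m x → x <F m
  m-before⇒< u al b = FP.≤∧≢⇒< (All.lookup al (Bef-∈ʳ b)) (λ { refl → Bef-irrefl u b })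

  ≼-erase : ∀ α β → Unique α → All (_≤F m) α → α ≼ β → erase α ≼ erase β × (∀ x → Bef α m x → Bef β m x)
  ≼-erase α β u al α≼β =
    (λ i j i<j b → Bef-erase (α≼β i j i<j (Bef-erase⁻ α b)) (λ { refl → m∉erase α (Bef-∈ˡ b) }) (λ { refl → m∉erase α (Bef-∈ʳ b) })) ,
    λ x b → α≼β x m (m-before⇒< u al b) b

  erase-≼ : ∀ α β → All (_≤F m) α → erase α ≼ erase β → (∀ x → Bef α m x → Bef β m x) → α ≼ β
  erase-≼ α β al h₁ h₂ i j i<j b with j ≟ m | i ≟ m
  ... | yes refl | _ = h₂ i b
  ... | no _ | yes refl = ⊥-elim (≤m⇒≯m (All.lookup al (Bef-∈ˡ b)) i<j)
  ... | no j≢m | no i≢m = Bef-erase⁻ β (h₁ i j i<j (Bef-erase b j≢m i≢m))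

  TargetIn : Maybe (Fin n) → Word → Set
  TargetIn nothing _ = ⊤
  TargetIn (just t) u = t ∈ u

  TargetIn? : ∀ t u → Dec (TargetIn t u)
  TargetIn? nothing _ = yes tt
  TargetIn? (just t) u = member? _≟_ t u

  -- BarrierBefore u t y : y is a barrier of u occurring before the target t
  -- (a structurally recursive form of Barrier u y × BeforeTarget u y t).
  BarrierBefore : Word → Maybe (Fin n) → Fin n → Set
  BarrierBefore [] _ _ = ⊥
  BarrierBefore (x ∷ u) t y = (x ≡ y × above y u <ℕ k × TargetIn t u) ⊎ BarrierBefore u t y

  BarrierBefore⇒ : ∀ u t {y} → BarrierBefore u t y → Barrier u y × BeforeTarget u y t
  BarrierBefore⇒ (_ ∷ _) nothing (inj₁ (refl , q , _)) = inj₁ (refl , q) , tt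
  BarrierBefore⇒ (_ ∷ _) (just _) (inj₁ (refl , q , p)) = inj₁ (refl , q) , now p
  BarrierBefore⇒ (_ ∷ u) t (inj₂ b) with BarrierBefore⇒ u t b
  ... | b₁ , b₂ = inj₂ b₁ , BeforeTarget-cons t b₂

  ⇒BarrierBefore : ∀ u t {y} → Unique u → Barrier u y → BeforeTarget u y t → BarrierBefore u t y
  ⇒BarrierBefore (_ ∷ _) nothing _ (inj₁ (refl , q)) _ = inj₁ (refl , q , tt)
  ⇒BarrierBefore (_ ∷ _) (just _) _ (inj₁ (refl , q)) (now p) = inj₁ (refl , q , p)
  ⇒BarrierBefore (_ ∷ _) (just _) (x≢ ∷ _) (inj₁ (refl , _)) (later b) = ⊥-elim (All≢⇒∉ x≢ (Bef-∈ˡ b))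
  ⇒BarrierBefore (_ ∷ u) t (x≢ ∷ u!) (inj₂ b) bt =
    inj₂ (⇒BarrierBefore u t u! b (BeforeTarget-tail t bt (λ { refl → All≢⇒∉ x≢ (Barrier⇒∈ b) })))

  BarrierBefore? : ∀ u t → Dec (∃ λ y → BarrierBefore u t y)
  BarrierBefore? [] _ = no λ ()
  BarrierBefore? (x ∷ u) t with above x u ℕ.<? k | TargetIn? t u | BarrierBefore? u t
  ... | _ | _ | yes (y , b) = yes (y , inj₂ b)
  ... | yes q | yes p | no _ = yes (x , inj₁ (refl , q , p))
  ... | yes _ | no ¬p | no ¬b = no λ { (_ , inj₁ (_ , _ , p)) → ¬p p ; (y , inj₂ b) → ¬b (y , b) }
  ... | no ¬q | _ | no ¬b = no λ { (_ , inj₁ (refl , q , _)) → ¬q q ; (y , inj₂ b) → ¬b (y , b) }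

  record TargetCut (u : Word) (t : Maybe (Fin n)) : Set where
    field
      pre post     : Word
      split        : u ≡ pre ++ post
      target-post  : ∀ t′ → t ≡ just t′ → t′ ∈ post
      post-after   : ∀ x → x ∈ post → Σ (Fin n) λ t′ → t ≡ just t′ × (x ≡ t′ ⊎ Bef u t′ x)

  targetCut : ∀ u t → TargetIn t u → TargetCut u t
  targetCut u nothing _ = record
    { pre = u ; post = [] ; split = sym (++-identityʳ u) ; target-post = λ _ () ; post-after = λ _ () }
  targetCut u (just t) t∈ with MP.∈-∃++ t∈
  ... | A , B , refl = record
    { pre = A ; post = t ∷ B ; split = refl
    ; target-post = λ { _ refl → here refl }
    ; post-after = λ { x (here refl) → t , refl , inj₁ refl ; x (there p) → t , refl , inj₂ (Bef-split A p) }
    }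

  record BarrierCut (u : Word) (t : Maybe (Fin n)) : Set where
    field
      pre post      : Word
      split         : u ≡ pre ++ post
      barriers-pre  : ∀ y → BarrierBefore u t y → y ∈ pre
      post-complete : ∀ x → x ∈ u → (∀ y → BarrierBefore u t y → Bef u y x) → x ∈ post

  barrierCut : ∀ u t → Unique u → BarrierCut u t
  barrierCut [] t _ = record { pre = [] ; post = [] ; split = refl ; barriers-pre = λ _ () ; post-complete = λ _ () }
  barrierCut (x ∷ u) t (x≢ ∷ u!) with BarrierBefore? u t
  ... | yes (y₀ , b₀) = record
    { pre = x ∷ pre ; post = post ; split = cong (x ∷_) split
    ; barriers-pre = λ { y (inj₁ (refl , _)) → here refl ; y (inj₂ b) → there (barriers-pre y b) }
    ; post-complete = λ x₀ _ all-before → post-complete x₀ (Bef-∈ʳ (tail-before all-before y₀ b₀)) (tail-before all-before)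
    }
    where
    open BarrierCut (barrierCut u t u!)
    tail-before : ∀ {x₀} → (∀ y → BarrierBefore (x ∷ u) t y → Bef (x ∷ u) y x₀) → ∀ y → BarrierBefore u t y → Bef u y x₀
    tail-before all-before y b =
      Bef-tail (all-before y (inj₂ b)) (λ { refl → All≢⇒∉ x≢ (Barrier⇒∈ (proj₁ (BarrierBefore⇒ u t b))) })
  ... | no ¬b with above x u ℕ.<? k | TargetIn? t u
  ...   | yes q | yes p = record
    { pre = [ x ] ; post = u ; split = refl
    ; barriers-pre = λ { y (inj₁ (refl , _)) → here refl ; y (inj₂ b) → ⊥-elim (¬b (y , b)) }
    ; post-complete = λ x₀ _ all-before → after-x (all-before x (inj₁ (refl , q , p)))
    }
    where
    after-x : ∀ {x₀} → Bef (x ∷ u) x x₀ → x₀ ∈ u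
    after-x (now r) = r
    after-x (later b) = ⊥-elim (All≢⇒∉ x≢ (Bef-∈ˡ b))
  ...   | yes _ | no ¬p = record
    { pre = [] ; post = x ∷ u ; split = refl
    ; barriers-pre = λ { y (inj₁ (_ , _ , p)) → ⊥-elim (¬p p) ; y (inj₂ b) → ⊥-elim (¬b (y , b)) }
    ; post-complete = λ _ x₀∈ _ → x₀∈
    }
  ...   | no ¬q | _ = record
    { pre = [] ; post = x ∷ u ; split = refl
    ; barriers-pre = λ { y (inj₁ (refl , q , _)) → ⊥-elim (¬q q) ; y (inj₂ b) → ⊥-elim (¬b (y , b)) }
    ; post-complete = λ _ x₀∈ _ → x₀∈
    }

module Extend (k n j : ℕ) (m : Fin n) (m≡j : toℕ m ≡ j) where
  open Words n
  open Twist k n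
  open RemoveMax k n m

  perm-m∈ : ∀ {w} → PermOf (suc j) w → m ∈ w
  perm-m∈ (_ , _ , complete) = complete m (subst (_<ℕ suc j) (sym m≡j) (NP.n<1+n j))

  perm-≤m : ∀ {w} → PermOf (suc j) w → All (_≤F m) w
  perm-≤m (_ , bounded , _) = All.tabulate (λ p → subst (_ ≤ℕ_) (sym m≡j) (NP.≤-pred (bounded p)))

  perm-m∉ : ∀ {w} → PermOf j w → m ∉ w
  perm-m∉ (_ , bounded , _) p = NP.<-irrefl m≡j (bounded p)

  erase-perm : ∀ {w} → PermOf (suc j) w → PermOf j (erase w)
  erase-perm {w} (u , bounded , complete) =
    Unique-erase w u ,
    (λ {x} p → below-j x (bounded (erase-⊆ w p)) (λ e → m∉erase w (subst (_∈ erase w) e p))) ,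
    λ x x<j → ∈-erase w (complete x (NP.m≤n⇒m≤1+n x<j)) (λ { refl → NP.<-irrefl m≡j x<j })
    where
    below-j : ∀ x → toℕ x <ℕ suc j → x ≢ m → toℕ x <ℕ j
    below-j x p x≢m = NP.≤∧≢⇒< (NP.≤-pred p) (λ e → x≢m (FP.toℕ-injective (trans e (sym m≡j))))

  insert-perm : ∀ X Y → PermOf j (X ++ Y) → PermOf (suc j) (X ++ m ∷ Y)
  insert-perm X Y P@(u , bounded , complete) = Unique-insert X u (perm-m∉ P) , bounded′ , complete′
    where
    bounded′ : ∀ {z} → z ∈ X ++ m ∷ Y → toℕ z <ℕ suc j
    bounded′ p with ∈-insert⁻ X p
    ... | inj₁ refl = subst (_<ℕ suc j) (sym m≡j) (NP.n<1+n j)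
    ... | inj₂ q = NP.m≤n⇒m≤1+n (bounded q)
    complete′ : ∀ z → toℕ z <ℕ suc j → z ∈ X ++ m ∷ Y
    complete′ z z<1+j with toℕ z ℕ.<? j
    ... | yes z<j = ∈-insert⁺ X (complete z z<j)
    ... | no z≮j = subst (_∈ X ++ m ∷ Y) z≡m (MP.∈-++⁺ʳ X (here refl))
      where
      z≡m : m ≡ z
      z≡m = FP.toℕ-injective (trans m≡j (sym (NP.≤-antisym (NP.≤-pred z<1+j) (NP.≮⇒≥ z≮j))))

  erase-cut : ∀ X Y → PermOf j (X ++ Y) → erase (X ++ m ∷ Y) ≡ X ++ Y
  erase-cut X Y P = erase-insert X Y (perm-m∉ P)

  m-before-cut : ∀ X Y {x} → PermOf j (X ++ Y) → Bef (X ++ m ∷ Y) m x → x ∈ Y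
  m-before-cut X Y P = Bef-split⁻ X (proj₁ (∉-++ X (perm-m∉ P))) (proj₂ (∉-++ X (perm-m∉ P)))

  module Class (σ : Word) (Pσ : PermOf (suc j) σ) (IH : IntervalClass j (erase σ)) where
    open IntervalClass IH renaming
      (lo to τ₀; hi to τ₀′; lo-perm to Pτ₀; hi-perm to Pτ₀′; sound to sound₀; complete to complete₀)

    σ₀ : Word
    σ₀ = erase σ

    Pσ₀ : PermOf j σ₀
    Pσ₀ = erase-perm Pσ

    t : Maybe (Fin n)
    t = nextBarrier σ

    t-ok : TargetBarrier t σ₀
    t-ok = nextBarrier-ok σ (proj₁ Pσ)

    τ₀≼τ₀′ : τ₀ ≼ τ₀′
    τ₀≼τ₀′ = let (lo≼σ₀ , σ₀≼hi) = sound₀ σ₀ Pσ₀ ε in ≼-trans lo≼σ₀ σ₀≼hi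

    σ₀≈τ₀ : σ₀ ≈ τ₀
    σ₀≈τ₀ = complete₀ τ₀ Pτ₀ (≼-refl , τ₀≼τ₀′)

    σ₀≈τ₀′ : σ₀ ≈ τ₀′
    σ₀≈τ₀′ = complete₀ τ₀′ Pτ₀′ (τ₀≼τ₀′ , ≼-refl)

    t∈τ₀ : TargetIn t τ₀
    t∈τ₀ = go t t-ok
      where
      go : ∀ t → TargetBarrier t σ₀ → TargetIn t τ₀
      go nothing _ = tt
      go (just t′) b = proj₂ (proj₂ Pτ₀) t′ (proj₁ (proj₂ Pσ₀) (Barrier⇒∈ b))

    open TargetCut (targetCut τ₀ t t∈τ₀) renaming (pre to X; post to Y; split to τ₀≡XY)
    open BarrierCut (barrierCut τ₀′ t (proj₁ Pτ₀′)) renaming (pre to X′; post to Y′; split to τ₀′≡XY′)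

    τ τ′ : Word
    τ = X ++ m ∷ Y
    τ′ = X′ ++ m ∷ Y′

    PXY : PermOf j (X ++ Y)
    PXY = subst (PermOf j) τ₀≡XY Pτ₀

    PXY′ : PermOf j (X′ ++ Y′)
    PXY′ = subst (PermOf j) τ₀′≡XY′ Pτ₀′

    Pτ : PermOf (suc j) τ
    Pτ = insert-perm X Y PXY

    Pτ′ : PermOf (suc j) τ′
    Pτ′ = insert-perm X′ Y′ PXY′

    erase-τ : erase τ ≡ τ₀
    erase-τ = trans (erase-cut X Y PXY) (sym τ₀≡XY)

    erase-τ′ : erase τ′ ≡ τ₀′
    erase-τ′ = trans (erase-cut X′ Y′ PXY′) (sym τ₀′≡XY′)

    -- τ is below the class: m precedes only the target and the letters the
    -- target precedes, and these orders persist in every member ρ.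
    lower-bound : ∀ ρ → PermOf (suc j) ρ → σ ≈ ρ → τ ≼ ρ
    lower-bound ρ Pρ σ≈ρ = erase-≼ τ ρ (perm-≤m Pτ) (subst (_≼ erase ρ) (sym erase-τ) τ₀≼ρ₀) m-first
      where
      σ₀≈ρ₀ : σ₀ ≈ erase ρ
      σ₀≈ρ₀ = erase-resp-≈ σ≈ρ (perm-≤m Pσ)
      τ₀≼ρ₀ : τ₀ ≼ erase ρ
      τ₀≼ρ₀ = proj₁ (sound₀ (erase ρ) (erase-perm Pρ) σ₀≈ρ₀)
      m-first : ∀ x → Bef τ m x → Bef ρ m x
      m-first x b with post-after x (m-before-cut X Y PXY b)
      ... | t′ , t≡t′ , x-after-t′ = after-t′ x-after-t′
        where
        m-before-t′ : Bef ρ m t′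
        m-before-t′ = m-before-nextBarrier ρ (trans (sym (nextBarrier-resp-≈ σ≈ρ (perm-≤m Pσ))) t≡t′) (perm-m∈ Pρ)
        t′-barrier : Barrier τ₀ t′
        t′-barrier = Barrier-resp-≈ σ₀≈τ₀ (subst (λ z → TargetBarrier z σ₀) t≡t′ t-ok)
        after-t′ : x ≡ t′ ⊎ Bef τ₀ t′ x → Bef ρ m x
        after-t′ (inj₁ refl) = m-before-t′
        after-t′ (inj₂ t′<x) = Bef-trans (proj₁ Pρ) m-before-t′
          (Bef-erase⁻ ρ (barrier-before-≼ (≈-sym σ₀≈τ₀ ◅◅ σ₀≈ρ₀) τ₀≼ρ₀ (proj₁ Pτ₀) t′-barrier t′<x))

    -- τ′ is above the class: in every member ρ, each letter preceded by m
    -- is preceded by all barriers before the target, and so lies after the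
    -- cut in τ₀′.
    upper-bound : ∀ ρ → PermOf (suc j) ρ → σ ≈ ρ → ρ ≼ τ′
    upper-bound ρ Pρ σ≈ρ = erase-≼ ρ τ′ (perm-≤m Pρ) (subst (erase ρ ≼_) (sym erase-τ′) ρ₀≼τ₀′) m-first
      where
      Pρ₀ : PermOf j (erase ρ)
      Pρ₀ = erase-perm Pρ
      σ₀≈ρ₀ : σ₀ ≈ erase ρ
      σ₀≈ρ₀ = erase-resp-≈ σ≈ρ (perm-≤m Pσ)
      ρ₀≈τ₀′ : erase ρ ≈ τ₀′
      ρ₀≈τ₀′ = ≈-sym σ₀≈ρ₀ ◅◅ σ₀≈τ₀′
      ρ₀≼τ₀′ : erase ρ ≼ τ₀′
      ρ₀≼τ₀′ = proj₂ (sound₀ (erase ρ) Pρ₀ σ₀≈ρ₀)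
      m-first : ∀ x → Bef ρ m x → Bef τ′ m x
      m-first x b = Bef-split X′ (post-complete x x∈τ₀′ barriers-before-x)
        where
        x≢m : x ≢ m
        x≢m e = FP.<-irrefl e (m-before⇒< (proj₁ Pρ) (perm-≤m Pρ) b)
        x∈τ₀′ : x ∈ τ₀′
        x∈τ₀′ = proj₂ (proj₂ Pτ₀′) x (proj₁ (proj₂ Pρ₀) (∈-erase ρ (Bef-∈ʳ b) x≢m))
        barriers-before-x : ∀ y → BarrierBefore τ₀′ t y → Bef τ₀′ y x
        barriers-before-x y bb with BarrierBefore⇒ τ₀′ t bb
        ... | y-barrier , y-before-t = barrier-before-≼ ρ₀≈τ₀′ ρ₀≼τ₀′ (proj₁ Pρ₀) y-barrier-ρ₀ y-before-x
          where
          y-barrier-ρ₀ : Barrier (erase ρ) y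
          y-barrier-ρ₀ = Barrier-resp-≈ (≈-sym ρ₀≈τ₀′) y-barrier
          y-before-t-ρ₀ : BeforeTarget (erase ρ) y t
          y-before-t-ρ₀ = BeforeTarget-resp-≈ t (≈-sym ρ₀≈τ₀′) (proj₁ Pτ₀′) y-barrier
                            (TargetBarrier-resp-≈ t σ₀≈τ₀′ t-ok) y-before-t
          y-before-m : Bef ρ y m
          y-before-m = barrier-before-m ρ (proj₁ Pρ) (perm-m∈ Pρ) y-barrier-ρ₀
                         (subst (BeforeTarget (erase ρ) y) (nextBarrier-resp-≈ σ≈ρ (perm-≤m Pσ)) y-before-t-ρ₀)
          y-before-x : Bef (erase ρ) y x
          y-before-x = Bef-erase (Bef-trans (proj₁ Pρ) y-before-m b)
                         (∈-erase⇒≢m ρ (Barrier⇒∈ y-barrier-ρ₀)) x≢m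

    -- Every ρ in the interval is in the class: the erased words lie in the
    -- smaller interval, and the bounds pin down the next barrier of ρ.
    in-class : ∀ ρ → PermOf (suc j) ρ → τ ≼ ρ → ρ ≼ τ′ → σ ≈ ρ
    in-class ρ Pρ τ≼ρ ρ≼τ′ =
      invariants⇒≈ (proj₁ Pσ) (perm-m∈ Pσ) (perm-≤m Pσ) (proj₁ Pρ) (perm-m∈ Pρ) (perm-≤m Pρ) σ₀≈ρ₀ (sym next-ρ)
      where
      lower = ≼-erase τ ρ (proj₁ Pτ) (perm-≤m Pτ) τ≼ρ
      upper = ≼-erase ρ τ′ (proj₁ Pρ) (perm-≤m Pρ) ρ≼τ′
      σ₀≈ρ₀ : σ₀ ≈ erase ρ
      σ₀≈ρ₀ = complete₀ (erase ρ) (erase-perm Pρ)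
                (subst (_≼ erase ρ) erase-τ (proj₁ lower) , subst (erase ρ ≼_) erase-τ′ (proj₁ upper))
      t-ok-ρ : TargetBarrier t (erase ρ)
      t-ok-ρ = TargetBarrier-resp-≈ t σ₀≈ρ₀ t-ok
      m-before-t : ∀ t′ → t ≡ just t′ → Bef ρ m t′
      m-before-t t′ e = proj₂ lower t′ (Bef-split X (target-post t′ e))
      barriers-before-m : ∀ y → Barrier (erase ρ) y → BeforeTarget (erase ρ) y t → Bef ρ y m
      barriers-before-m y bar bt with Bef-total (erase-⊆ ρ (Barrier⇒∈ bar)) (perm-m∈ Pρ) (∈-erase⇒≢m ρ (Barrier⇒∈ bar))
      ... | inj₁ y-before-m = y-before-m
      ... | inj₂ m-before-y = ⊥-elim (Unique-disjoint X′ (proj₁ PXY′) (barriers-pre y bb)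
                                (m-before-cut X′ Y′ PXY′ (proj₂ upper y m-before-y)))
        where
        ρ₀≈τ₀′ : erase ρ ≈ τ₀′
        ρ₀≈τ₀′ = ≈-sym σ₀≈ρ₀ ◅◅ σ₀≈τ₀′
        bb : BarrierBefore τ₀′ t y
        bb = ⇒BarrierBefore τ₀′ t (proj₁ Pτ₀′) (Barrier-resp-≈ ρ₀≈τ₀′ bar)
               (BeforeTarget-resp-≈ t ρ₀≈τ₀′ (proj₁ (erase-perm Pρ)) bar t-ok-ρ bt)
      next-ρ : nextBarrier ρ ≡ t
      next-ρ = nextBarrier-unique ρ t (proj₁ Pρ) (perm-m∈ Pρ) t-ok-ρ m-before-t barriers-before-m

    extend : IntervalClass (suc j) σ
    extend = record
      { lo = τ ; hi = τ′ ; lo-perm = Pτ ; hi-perm = Pτ′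
      ; sound = λ ρ Pρ σ≈ρ → lower-bound ρ Pρ σ≈ρ , upper-bound ρ Pρ σ≈ρ
      ; complete = λ ρ Pρ (τ≼ρ , ρ≼τ′) → in-class ρ Pρ τ≼ρ ρ≼τ′
      }

module Classes (k n : ℕ) where
  open Words n
  open Twist k n

  empty-class : ∀ σ → PermOf 0 σ → IntervalClass 0 σ
  empty-class σ P with PermOf-0 P
  ... | refl = record
    { lo = [] ; hi = [] ; lo-perm = P ; hi-perm = P
    ; sound = λ ρ Pρ _ → subst ([] ≼_) (sym (PermOf-0 Pρ)) ≼-refl , subst (_≼ []) (sym (PermOf-0 Pρ)) ≼-refl
    ; complete = λ ρ Pρ _ → subst ([] ≈_) (sym (PermOf-0 Pρ)) ε
    }

  interval-class : ∀ j → j ≤ℕ n → ∀ σ → PermOf j σ → IntervalClass j σ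
  interval-class zero _ σ P = empty-class σ P
  interval-class (suc j) j<n σ P =
    Class.extend σ P (interval-class j (NP.<⇒≤ j<n) (RemoveMax.erase k n m σ) (erase-perm P))
    where
    m : Fin n
    m = fromℕ< j<n
    open Extend k n j m (FP.toℕ-fromℕ< j<n)

proposition32 : (k n : ℕ) (σ : List (Fin n)) → IsPerm n σ →
    Σ (List (Fin n)) λ τ → Σ (List (Fin n)) λ τ′ → IsPerm n τ × IsPerm n τ′ ×
      ((ρ : List (Fin n)) → IsPerm n ρ → (σ ≡[ k ]ᵗ ρ ⇔ (τ ≤W ρ × ρ ≤W τ′)))
proposition32 k n σ σ-perm =
  lo , hi , PermOf⇒IsPerm lo-perm , PermOf⇒IsPerm hi-perm , λ ρ ρ-perm →
    mk⇔ (λ σ≡ρ → let (lo≼ρ , ρ≼hi) = sound ρ (IsPerm⇒PermOf ρ-perm) (≡ᵗ⇒≈ σ≡ρ) in ≼⇒≤W lo≼ρ , ≼⇒≤W ρ≼hi)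
        (λ (lo≤ρ , ρ≤hi) → ≈⇒≡ᵗ (complete ρ (IsPerm⇒PermOf ρ-perm) (≤W⇒≼ lo≤ρ , ≤W⇒≼ ρ≤hi)))
  where
  open Words n
  open Twist k n
  open IntervalClass (Classes.interval-class k n n NP.≤-refl σ (IsPerm⇒PermOf σ-perm))
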